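{- Let $n\geq r\geq 1$ be integers. Then $\left[ p_{n}^{(r)}\right]_q$ equals the determinant of the $(n-r+1)\times(n-r+1)$ matrix $M=(M_{i,j})_{0\leq i,j\leq n-r}$ given by $$M_{i,0}=\begin{bmatrix} r+i\\ r\end{bmatrix}_q e_{r+i}\quad(0\leq i\leq n-r),\qquad M_{i,j}=e_{i-j+1}\quad(0\leq i\leq n-r,\ 1\leq j\leq n-r),$$ with the conventions $e_0=1$ and $e_k=0$ for $k<0$. (So the first column is $\binom{r}{r}_q e_r,\binom{r+1}{r}_q e_{r+1},\dots,\binom{n}{r}_q e_n$ in $q$-binomial form, and the remaining columns form a lower Hessenberg Toeplitz block with $1$'s on the superdiagonal and $e_1$ on the diagonal.)
   Context: Let $\Lambda$ be the ring of symmetric functions in infinitely many variables $x_1,x_2,\dots$ with coefficients in $\mathbb{Q}(q)$, and let $e_n$ denote the elementary symmetric functions ($e_0=1$), with $E(t)=\sum_{n\geq 0}e_nt^n=\prod_{i\geq1}(1+x_it)$. For $n\geq 1$, $[n]_q=1+q+\dots+q^{n-1}$, $[0]_q=0$, $[n]_q!=[1]_q[2]_q\cdots[n]_q$, $[0]_q!=1$, and $\begin{bmatrix} n\\ k\end{bmatrix}_q=\frac{[n]_q!}{[k]_q![n-k]_q!}$ for $n\geq k\geq 0$ (and $0$ otherwise). The $q$-derivative of a formal series $F(t)$ is $D_qF(t)=\frac{F(qt)-F(t)}{(q-1)t}$, with $D_q^0F=F$ and $D_q^r=D_q\circ D_q^{r-1}$. The elements $\left[ p_{n}^{(r)}\right]_q\in\Lambda$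 for $n\geq r\geq 0$ are defined by the generating function identity $\sum_{n\geq r}\left[ p_{n}^{(r)}\right]_q(-t)^{n-r}=\frac{1}{[r]_q!}\frac{D_q^rE(t)}{E(t)}$. -}

module Defs where

open import Level using (Level)
open import Algebra.Bundles using (CommutativeRing)
open import Data.Nat as ℕ using (ℕ; zero; suc; _∸_; _≤?_)
open import Data.Fin as Fin using (Fin; toℕ; punchIn)
open import Relation.Nullary using (yes; no)

module _ {c ℓ : Level} (R : CommutativeRing c ℓ) where
  open CommutativeRing R

  pow : Carrier → ℕ → Carrier
  pow x zero    = 1#
  pow x (suc n) = x * pow x n

  sgn : ℕ → Carrier
  sgn n = pow (- 1#) n

  sumTo : ℕ → (ℕ → Carrier) → Carrier
  sumTo zero    f = 0#
  sumTo (suc n) f = sumTo n f + f n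

  sumFin : (n : ℕ) → (Fin n → Carrier) → Carrier
  sumFin zero    f = 0#
  sumFin (suc n) f = f Fin.zero + sumFin n (λ j → f (Fin.suc j))

  qint : Carrier → ℕ → Carrier
  qint q n = sumTo n (pow q)

  qfact : Carrier → ℕ → Carrier
  qfact q zero    = 1#
  qfact q (suc n) = qfact q n * qint q (suc n)

  -- q-binomial coefficient via the q-Pascal rule (0 when k > n)
  qbinom : Carrier → ℕ → ℕ → Carrier
  qbinom q n       zero    = 1#
  qbinom q zero    (suc k) = 0#
  qbinom q (suc n) (suc k) = qbinom q n k + pow q (suc k) * qbinom q n (suc k)

  -- formal power series in t: coefficient sequences
  Series : Set c
  Series = ℕ → Carrier

  _⊛_ : Series → Series → Series
  (a ⊛ b) m = sumTo (suc m) (λ k → a k * b (m ∸ k))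

  -- q-derivative D_q F(t) = (F(qt) - F(t)) / ((q-1) t), coefficientwise:
  -- D_q (Σ c_n t^n) = Σ [n+1]_q c_{n+1} t^n
  Dq : Carrier → Series → Series
  Dq q F m = qint q (suc m) * F (suc m)

  Dq^ : Carrier → ℕ → Series → Series
  Dq^ q zero    F = F
  Dq^ q (suc r) F = Dq q (Dq^ q r F)

  _·ₛ_ : Carrier → Series → Series
  (x ·ₛ F) m = x * F m

  _≈ₛ_ : Series → Series → Set ℓ
  F ≈ₛ G = ∀ m → F m ≈ G m

  -- Σ_{n ≥ r} P n (-t)^{n-r}
  shiftedAltSeries : (ℕ → Carrier) → ℕ → Series
  shiftedAltSeries P r m = sgn m * P (r ℕ.+ m)

  -- P is the family [p_n^(r)]_q (n ≥ r) for the elementary family e, i.e.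
  --   Σ_{n≥r} P n (-t)^{n-r} = (1/[r]_q!) D_q^r E(t) / E(t),
  -- written without division as
  --   [r]_q! · (Σ_{n≥r} P n (-t)^{n-r}) · E(t) = D_q^r E(t).
  IsQPowerSum : Carrier → (ℕ → Carrier) → ℕ → (ℕ → Carrier) → Set ℓ
  IsQPowerSum q e r P =
    (qfact q r ·ₛ (shiftedAltSeries P r ⊛ e)) ≈ₛ Dq^ q r e

  Matrix : ℕ → Set c
  Matrix n = Fin n → Fin n → Carrier

  det : (n : ℕ) → Matrix n → Carrier
  det zero    M = 1#
  det (suc n) M =
    sumFin (suc n) (λ j → sgn (toℕ j) * (M Fin.zero j
                      * det n (λ a b → M (Fin.suc a) (punchIn j b))))

  eDiff : (ℕ → Carrier) → ℕ → ℕ → Carrier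
  eDiff e i j with j ≤? i
  ... | yes _ = e (i ∸ j)
  ... | no  _ = 0#

  -- the (n-r+1)×(n-r+1) matrix of the proposition, with m = n - r
  -- M_{i,0} = [r+i choose r]_q e_{r+i},  M_{i,j} = e_{i-j+1} (j ≥ 1)
  pMatrix : Carrier → (ℕ → Carrier) → (r m : ℕ) → Matrix (suc m)
  pMatrix q e r m i Fin.zero    = qbinom q (r ℕ.+ toℕ i) r * e (r ℕ.+ toℕ i)
  pMatrix q e r m i (Fin.suc j) = eDiff e (toℕ i) (toℕ j)

-- Write A for the series Σ_{n≥r} P n (-t)^{n-r}.  The defining identity says A · E = D_q^r E / [r]_q!,
-- whose k-th coefficient is [r+k choose r]_q e_{r+k}: this is the first column of the matrix.  So it
-- suffices that the lower Hessenberg determinant H_m(b) with first column (b_0, …, b_m) and e_{i-j+1}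
-- elsewhere inverts multiplication by E: H_m(A · E) = (-1)^m A_m.  Expanding along the first row
-- gives H_{m+1}(b) = b_0 H_m(e_{·+1}) − H_m(b_{·+1}), so H_m is linear in b, and induction on m
-- finishes it.
module Submission where

open import Defs
open import Level using (Level)
open import Algebra.Bundles using (CommutativeRing)
open import Data.Nat as ℕ using (ℕ; zero; suc; _≤_; _<_; _∸_; s≤s; z≤n; s≤s⁻¹)
import Data.Nat.Properties as ℕₚ
open import Data.Fin as Fin using (Fin; toℕ; punchIn)
open import Function using (_∘_)
open import Relation.Nullary using (yes; no)
open import Relation.Nullary.Negation using (contradiction)
import Relation.Binary.PropositionalEquality as ≡

module _ {c ℓ : Level} (R : CommutativeRing c ℓ) where
  open CommutativeRing R
  open import Algebra.Properties.Ring ring using (-1*x≈-x; -‿distribʳ-*; -‿involutive; +-cancelʳ)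
  open import Algebra.Properties.Group +-group using (//-rightDividesˡ; \\-leftDividesʳ)
  open import Algebra.Solver.Ring.NaturalCoefficients.Default commutativeSemiring
    using (solve; _:=_; _:+_; _:*_)
  open import Relation.Binary.Reasoning.Setoid setoid

  sumTo-suc : ∀ n (f : ℕ → Carrier) → sumTo R (suc n) f ≈ f 0 + sumTo R n (f ∘ suc)
  sumTo-suc zero    f = trans (+-identityˡ _) (sym (+-identityʳ _))
  sumTo-suc (suc n) f = trans (+-congʳ (sumTo-suc n f)) (+-assoc _ _ _)

  sumTo-*ˡ : ∀ n a (f : ℕ → Carrier) → sumTo R n (λ k → a * f k) ≈ a * sumTo R n f
  sumTo-*ˡ zero    a f = sym (zeroʳ a)
  sumTo-*ˡ (suc n) a f = trans (+-congʳ (sumTo-*ˡ n a f)) (sym (distribˡ a _ _))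

  sumFin-cong : ∀ n {f g : Fin n → Carrier} → (∀ j → f j ≈ g j) → sumFin R n f ≈ sumFin R n g
  sumFin-cong zero    f≈g = refl
  sumFin-cong (suc n) f≈g = +-cong (f≈g Fin.zero) (sumFin-cong n (f≈g ∘ Fin.suc))

  sumFin-≈0 : ∀ n {f : Fin n → Carrier} → (∀ j → f j ≈ 0#) → sumFin R n f ≈ 0#
  sumFin-≈0 zero    f≈0 = refl
  sumFin-≈0 (suc n) f≈0 =
    trans (+-cong (f≈0 Fin.zero) (sumFin-≈0 n (f≈0 ∘ Fin.suc))) (+-identityˡ 0#)

  det-cong : ∀ n {M N : Matrix R n} → (∀ a b → M a b ≈ N a b) → det R n M ≈ det R n N
  det-cong zero    M≈N = refl
  det-cong (suc n) M≈N = sumFin-cong (suc n) λ j →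
    *-congˡ {sgn R (toℕ j)}
      (*-cong (M≈N Fin.zero j) (det-cong n λ a b → M≈N (Fin.suc a) (punchIn j b)))

  sgn-suc : ∀ m x → sgn R (suc m) * x ≈ - (sgn R m * x)
  sgn-suc m x = trans (*-assoc _ _ _) (-1*x≈-x _)

  sgn-*-sgn : ∀ m x → sgn R m * (sgn R m * x) ≈ x
  sgn-*-sgn zero    x = trans (*-identityˡ _) (*-identityˡ _)
  sgn-*-sgn (suc m) x = begin
    sgn R (suc m) * (sgn R (suc m) * x)  ≈⟨ *-congˡ (sgn-suc m x) ⟩
    sgn R (suc m) * - (sgn R m * x)      ≈⟨ sgn-suc m _ ⟩
    - (sgn R m * - (sgn R m * x))        ≈⟨ -‿cong (-‿distribʳ-* _ _) ⟨
    - - (sgn R m * (sgn R m * x))        ≈⟨ -‿involutive _ ⟩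
    sgn R m * (sgn R m * x)              ≈⟨ sgn-*-sgn m x ⟩
    x                                    ∎

  module Hessenberg (e : ℕ → Carrier) (e₀≈1 : e 0 ≈ 1#) where

    eDiff-suc : ∀ i j → eDiff R e (suc i) (suc j) ≈ eDiff R e i j
    eDiff-suc i j with suc j ℕ.≤? suc i | j ℕ.≤? i
    ... | yes _   | yes _   = refl
    ... | no _    | no _    = refl
    ... | yes j<i | no j≰i  = contradiction (s≤s⁻¹ j<i) j≰i
    ... | no j≮i  | yes j≤i = contradiction (s≤s j≤i) j≮i

    eDiff-zero : ∀ i → eDiff R e i 0 ≈ e i
    eDiff-zero i with 0 ℕ.≤? i
    ... | yes _  = refl
    ... | no 0≰i = contradiction z≤n 0≰i

    eDiff-zero-suc : ∀ j → eDiff R e 0 (suc j) ≈ 0#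
    eDiff-zero-suc j with suc j ℕ.≤? 0
    ... | no _ = refl

    hessenberg : (m : ℕ) → (ℕ → Carrier) → Matrix R (suc m)
    hessenberg m b i Fin.zero    = b (toℕ i)
    hessenberg m b i (Fin.suc j) = eDiff R e (toℕ i) (toℕ j)

    hdet : ℕ → (ℕ → Carrier) → Carrier
    hdet m b = det R (suc m) (hessenberg m b)

    hdet-cong : ∀ m {b b′ : ℕ → Carrier} → (∀ k → b k ≈ b′ k) → hdet m b ≈ hdet m b′
    hdet-cong m {b} {b′} b≈b′ = det-cong (suc m) {hessenberg m b} {hessenberg m b′} λ where
      a Fin.zero    → b≈b′ (toℕ a)
      a (Fin.suc j) → refl

    hdet-zero : ∀ b → hdet 0 b ≈ b 0
    hdet-zero b = trans (+-identityʳ _) (trans (*-identityˡ _) (*-identityʳ _))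

    minor : (m : ℕ) → (ℕ → Carrier) → Fin (suc (suc m)) → Matrix R (suc m)
    minor m b j a k = hessenberg (suc m) b (Fin.suc a) (punchIn j k)

    det-minor-zero : ∀ m b → det R (suc m) (minor m b Fin.zero) ≈ hdet m (e ∘ suc)
    det-minor-zero m b = det-cong (suc m) {minor m b Fin.zero} {hessenberg m (e ∘ suc)} λ where
      a Fin.zero    → eDiff-zero (suc (toℕ a))
      a (Fin.suc k) → eDiff-suc (toℕ a) (toℕ k)

    det-minor-one : ∀ m b → det R (suc m) (minor m b (Fin.suc Fin.zero)) ≈ hdet m (b ∘ suc)
    det-minor-one m b = det-cong (suc m) {minor m b (Fin.suc Fin.zero)} {hessenberg m (b ∘ suc)} λ where
      a Fin.zero    → refl
      a (Fin.suc k) → eDiff-suc (toℕ a) (toℕ k)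

    -- Expansion along the first row (b₀, e₀, 0, …, 0).
    hdet-suc : ∀ m b → hdet (suc m) b + hdet m (b ∘ suc) ≈ b 0 * hdet m (e ∘ suc)
    hdet-suc m b = begin
      hdet (suc m) b + hdet m (b ∘ suc)
        ≈⟨ +-congʳ (+-cong first (+-cong second rest)) ⟩
      (b 0 * hdet m (e ∘ suc) + (- hdet m (b ∘ suc) + 0#)) + hdet m (b ∘ suc)
        ≈⟨ +-congʳ (+-congˡ (+-identityʳ _)) ⟩
      (b 0 * hdet m (e ∘ suc) + - hdet m (b ∘ suc)) + hdet m (b ∘ suc)
        ≈⟨ //-rightDividesˡ _ _ ⟩
      b 0 * hdet m (e ∘ suc) ∎
      where
      first : sgn R 0 * (b 0 * det R (suc m) (minor m b Fin.zero)) ≈ b 0 * hdet m (e ∘ suc)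
      first = trans (*-identityˡ _) (*-congˡ (det-minor-zero m b))
      second : sgn R 1 * (eDiff R e 0 0 * det R (suc m) (minor m b (Fin.suc Fin.zero)))
               ≈ - hdet m (b ∘ suc)
      second = trans (*-cong (*-identityʳ (- 1#))
                       (trans (*-cong (trans (eDiff-zero 0) e₀≈1) (det-minor-one m b)) (*-identityˡ _)))
                     (-1*x≈-x _)
      rest : sumFin R m (λ j → sgn R (2 ℕ.+ toℕ j)
               * (eDiff R e 0 (suc (toℕ j)) * det R (suc m) (minor m b (Fin.suc (Fin.suc j))))) ≈ 0#
      rest = sumFin-≈0 m λ j →
        trans (*-congˡ (trans (*-congʳ (eDiff-zero-suc (toℕ j))) (zeroˡ _))) (zeroʳ _)

    hdet-linear : ∀ m b x d → hdet m (λ k → b k + x * d k) ≈ hdet m b + x * hdet m d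
    hdet-linear zero b x d =
      trans (hdet-zero (λ k → b k + x * d k)) (+-cong (sym (hdet-zero b)) (*-congˡ (sym (hdet-zero d))))
    hdet-linear (suc m) b x d = +-cancelʳ (hdet m (b ∘ suc) + x * hdet m (d ∘ suc)) _ _ (begin
      hdet (suc m) b+xd + (hdet m (b ∘ suc) + x * hdet m (d ∘ suc))
        ≈⟨ +-congˡ (hdet-linear m (b ∘ suc) x (d ∘ suc)) ⟨
      hdet (suc m) b+xd + hdet m (b+xd ∘ suc)
        ≈⟨ hdet-suc m b+xd ⟩
      (b 0 + x * d 0) * K
        ≈⟨ solve 4 (λ b₀ x d₀ K → (b₀ :+ x :* d₀) :* K := b₀ :* K :+ x :* (d₀ :* K))
             refl (b 0) x (d 0) K ⟩
      b 0 * K + x * (d 0 * K)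
        ≈⟨ +-cong (hdet-suc m b) (*-congˡ (hdet-suc m d)) ⟨
      (hdet (suc m) b + hdet m (b ∘ suc)) + x * (hdet (suc m) d + hdet m (d ∘ suc))
        ≈⟨ solve 5 (λ B B′ x D D′ →
                      (B :+ B′) :+ x :* (D :+ D′) := (B :+ x :* D) :+ (B′ :+ x :* D′))
             refl (hdet (suc m) b) (hdet m (b ∘ suc)) x (hdet (suc m) d) (hdet m (d ∘ suc)) ⟩
      (hdet (suc m) b + x * hdet (suc m) d) + (hdet m (b ∘ suc) + x * hdet m (d ∘ suc)) ∎)
      where
      b+xd : ℕ → Carrier
      b+xd k = b k + x * d k
      K : Carrier
      K = hdet m (e ∘ suc)

    _·E : Series R → Series R
    x ·E = _⊛_ R x e

    ·E-zero : ∀ x → (x ·E) 0 ≈ x 0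
    ·E-zero x = trans (+-identityˡ _) (trans (*-congˡ e₀≈1) (*-identityʳ _))

    ·E-suc : ∀ x k → (x ·E) (suc k) ≈ ((x ∘ suc) ·E) k + x 0 * e (suc k)
    ·E-suc x k = trans (sumTo-suc (suc k) (λ i → x i * e (suc k ∸ i))) (+-comm _ _)

    hdet-·E : ∀ m x → hdet m (x ·E) ≈ sgn R m * x m
    hdet-·E zero    x = trans (hdet-zero (x ·E)) (trans (·E-zero x) (sym (*-identityˡ _)))
    hdet-·E (suc m) x = +-cancelʳ (sgn R m * x (suc m) + x 0 * K) _ _ (begin
      hdet (suc m) (x ·E) + (sgn R m * x (suc m) + x 0 * K)  ≈⟨ +-congˡ hdet-tail ⟨
      hdet (suc m) (x ·E) + hdet m ((x ·E) ∘ suc)           ≈⟨ hdet-suc m (x ·E) ⟩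
      (x ·E) 0 * K                                          ≈⟨ *-congʳ (·E-zero x) ⟩
      x 0 * K                                               ≈⟨ \\-leftDividesʳ _ _ ⟨
      - (sgn R m * x (suc m)) + (sgn R m * x (suc m) + x 0 * K)
        ≈⟨ +-congʳ (sgn-suc m _) ⟨
      sgn R (suc m) * x (suc m) + (sgn R m * x (suc m) + x 0 * K) ∎)
      where
      K : Carrier
      K = hdet m (e ∘ suc)
      hdet-tail : hdet m ((x ·E) ∘ suc) ≈ sgn R m * x (suc m) + x 0 * K
      hdet-tail = begin
        hdet m ((x ·E) ∘ suc)                              ≈⟨ hdet-cong m (·E-suc x) ⟩
        hdet m (λ k → ((x ∘ suc) ·E) k + x 0 * e (suc k))  ≈⟨ hdet-linear m _ (x 0) (e ∘ suc) ⟩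
        hdet m ((x ∘ suc) ·E) + x 0 * K                    ≈⟨ +-congʳ (hdet-·E m (x ∘ suc)) ⟩
        sgn R m * x (suc m) + x 0 * K                      ∎

  module _ (q : Carrier) where

    qint-suc : ∀ n → qint R q (suc n) ≈ 1# + q * qint R q n
    qint-suc n = trans (sumTo-suc n (pow R q)) (+-congˡ (sumTo-*ˡ n q (pow R q)))

    qint-+ : ∀ a b → qint R q (a ℕ.+ b) ≈ qint R q a + pow R q a * qint R q b
    qint-+ zero    b = sym (trans (+-identityˡ _) (*-identityˡ _))
    qint-+ (suc a) b = begin
      qint R q (suc (a ℕ.+ b))                         ≈⟨ qint-suc (a ℕ.+ b) ⟩
      1# + q * qint R q (a ℕ.+ b)                      ≈⟨ +-congˡ (*-congˡ (qint-+ a b)) ⟩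
      1# + q * (qint R q a + pow R q a * qint R q b)
        ≈⟨ solve 5 (λ o x u v w → o :+ x :* (u :+ v :* w) := (o :+ x :* u) :+ (x :* v) :* w)
             refl 1# q (qint R q a) (pow R q a) (qint R q b) ⟩
      (1# + q * qint R q a) + pow R q (suc a) * qint R q b  ≈⟨ +-congʳ (qint-suc a) ⟨
      qint R q (suc a) + pow R q (suc a) * qint R q b      ∎

    qrising : ℕ → ℕ → Carrier
    qrising zero    m = 1#
    qrising (suc k) m = qint R q (suc m) * qrising k (suc m)

    qrising-suc : ∀ k m → qrising (suc k) m ≈ qrising k m * qint R q (suc (k ℕ.+ m))
    qrising-suc zero    m = *-comm _ _
    qrising-suc (suc k) m = begin
      qint R q (suc m) * qrising (suc k) (suc m)
        ≈⟨ *-congˡ (qrising-suc k (suc m)) ⟩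
      qint R q (suc m) * (qrising k (suc m) * qint R q (suc (k ℕ.+ suc m)))
        ≈⟨ *-assoc _ _ _ ⟨
      qrising (suc k) m * qint R q (suc (k ℕ.+ suc m))
        ≡⟨ ≡.cong (λ t → qrising (suc k) m * qint R q (suc t)) (ℕₚ.+-suc k m) ⟩
      qrising (suc k) m * qint R q (suc (suc k ℕ.+ m)) ∎

    qbinom-> : ∀ {n k} → n < k → qbinom R q n k ≈ 0#
    qbinom-> {zero}  {suc k} _       = refl
    qbinom-> {suc n} {suc k} (s≤s n<k) =
      trans (+-cong (qbinom-> n<k) (trans (*-congˡ (qbinom-> (ℕₚ.m<n⇒m<1+n n<k))) (zeroʳ _)))
            (+-identityʳ 0#)

    qfact*qbinom     : ∀ k m → qfact R q k * qbinom R q (k ℕ.+ m) k ≈ qrising k m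
    qfact*qbinom-suc : ∀ k m →
      qfact R q (suc k) * qbinom R q (k ℕ.+ m) (suc k) ≈ qrising k m * qint R q m

    qfact*qbinom zero    m = *-identityˡ 1#
    qfact*qbinom (suc k) m = begin
      (F * I) * (B₀ + Q * B₁)
        ≈⟨ solve 5 (λ f i b₀ p b₁ →
                      (f :* i) :* (b₀ :+ p :* b₁) := i :* (f :* b₀) :+ p :* ((f :* i) :* b₁))
             refl F I B₀ Q B₁ ⟩
      I * (F * B₀) + Q * ((F * I) * B₁)
        ≈⟨ +-cong (*-congˡ (qfact*qbinom k m)) (*-congˡ (qfact*qbinom-suc k m)) ⟩
      I * qrising k m + Q * (qrising k m * qint R q m)
        ≈⟨ solve 4 (λ i ρ p j → i :* ρ :+ p :* (ρ :* j) := ρ :* (i :+ p :* j))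
             refl I (qrising k m) Q (qint R q m) ⟩
      qrising k m * (I + Q * qint R q m)       ≈⟨ *-congˡ (qint-+ (suc k) m) ⟨
      qrising k m * qint R q (suc (k ℕ.+ m))   ≈⟨ qrising-suc k m ⟨
      qrising (suc k) m                         ∎
      where
      F I Q B₀ B₁ : Carrier
      F  = qfact R q k
      I  = qint R q (suc k)
      Q  = pow R q (suc k)
      B₀ = qbinom R q (k ℕ.+ m) k
      B₁ = qbinom R q (k ℕ.+ m) (suc k)

    qfact*qbinom-suc k zero = begin
      qfact R q (suc k) * qbinom R q (k ℕ.+ 0) (suc k)
        ≈⟨ *-congˡ (qbinom-> (s≤s (ℕₚ.≤-reflexive (ℕₚ.+-identityʳ k)))) ⟩
      qfact R q (suc k) * 0#  ≈⟨ zeroʳ _ ⟩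
      0#                      ≈⟨ zeroʳ _ ⟨
      qrising k 0 * 0#        ∎
    qfact*qbinom-suc k (suc m) = begin
      qfact R q (suc k) * qbinom R q (k ℕ.+ suc m) (suc k)
        ≡⟨ ≡.cong (λ t → qfact R q (suc k) * qbinom R q t (suc k)) (ℕₚ.+-suc k m) ⟩
      qfact R q (suc k) * qbinom R q (suc k ℕ.+ m) (suc k)  ≈⟨ qfact*qbinom (suc k) m ⟩
      qint R q (suc m) * qrising k (suc m)                  ≈⟨ *-comm _ _ ⟩
      qrising k (suc m) * qint R q (suc m)                  ∎

    Dq^-coefficient : ∀ (e : ℕ → Carrier) r k → Dq^ R q r e k ≈ qrising r k * e (r ℕ.+ k)
    Dq^-coefficient e zero    k = sym (*-identityˡ _)
    Dq^-coefficient e (suc r) k = begin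
      qint R q (suc k) * Dq^ R q r e (suc k)
        ≈⟨ *-congˡ (Dq^-coefficient e r (suc k)) ⟩
      qint R q (suc k) * (qrising r (suc k) * e (r ℕ.+ suc k))
        ≈⟨ *-assoc _ _ _ ⟨
      qrising (suc r) k * e (r ℕ.+ suc k)
        ≡⟨ ≡.cong (λ t → qrising (suc r) k * e t) (ℕₚ.+-suc r k) ⟩
      qrising (suc r) k * e (suc r ℕ.+ k) ∎

  qPowerSum≈det-pMatrix : ∀ q e → e 0 ≈ 1# → ∀ r m →
    ((x y : Carrier) → qfact R q r * x ≈ qfact R q r * y → x ≈ y) →
    (P : ℕ → Carrier) → IsQPowerSum R q e r P →
    P (r ℕ.+ m) ≈ det R (suc m) (pMatrix R q e r m)
  qPowerSum≈det-pMatrix q e e₀≈1 r m qfact-cancel P isQPowerSum = begin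
    P (r ℕ.+ m)                ≈⟨ sgn-*-sgn m _ ⟨
    sgn R m * A m              ≈⟨ hdet-·E m A ⟨
    hdet m (A ·E)              ≈⟨ hdet-cong m A·E≈column ⟩
    hdet m column              ≈⟨ det-cong (suc m) {hessenberg m column} {pMatrix R q e r m} (λ where
                                    i Fin.zero    → refl
                                    i (Fin.suc j) → refl) ⟩
    det R (suc m) (pMatrix R q e r m) ∎
    where
    open Hessenberg e e₀≈1
    A : Series R
    A = shiftedAltSeries R P r
    column : ℕ → Carrier
    column k = qbinom R q (r ℕ.+ k) r * e (r ℕ.+ k)
    A·E≈column : ∀ k → (A ·E) k ≈ column k
    A·E≈column k = qfact-cancel _ _ (begin
      qfact R q r * (A ·E) k                                ≈⟨ isQPowerSum k ⟩
      Dq^ R q r e k                                         ≈⟨ Dq^-coefficient q e r k ⟩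
      qrising q r k * e (r ℕ.+ k)                           ≈⟨ *-congʳ (qfact*qbinom q r k) ⟨
      (qfact R q r * qbinom R q (r ℕ.+ k) r) * e (r ℕ.+ k)  ≈⟨ *-assoc _ _ _ ⟩
      qfact R q r * column k                                ∎)

proposition3p3 : {c ℓ : Level} (R : CommutativeRing c ℓ) →
    let open CommutativeRing R in
    (q : Carrier) (e : ℕ → Carrier) → e 0 ≈ 1# →
    (r n : ℕ) → 1 ≤ r → r ≤ n →
    ((x y : Carrier) → qfact R q r * x ≈ qfact R q r * y → x ≈ y) →
    (P : ℕ → Carrier) → IsQPowerSum R q e r P →
    P n ≈ det R (suc (n ∸ r)) (pMatrix R q e r (n ∸ r))
proposition3p3 R q e e₀≈1 r n _ r≤n qfact-cancel P isQPowerSum =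
  ≡.subst (λ k → P k ≈ det R (suc (n ∸ r)) (pMatrix R q e r (n ∸ r))) (ℕₚ.m+[n∸m]≡n r≤n)
    (qPowerSum≈det-pMatrix R q e e₀≈1 r (n ∸ r) qfact-cancel P isQPowerSum)
  where open CommutativeRing R using (_≈_)
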